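{- Let $w\in\mathfrak{S}_N$. If $w$ has no $N$-occurrences of any of the patterns $45231$, $45132$, $43512$, $34512$, $35412$, $45123$, $45213$, then every $N$-occurrence of $3412$ in $w$ is equal to $\mathfrak{p}_k(w)$ for some $k\in\mathrm{newrep}(w)$.
   Context: Permutations are written in one-line notation; $s_i$ is the simple reflection interchanging $i$ and $i+1$; $\mathrm{supp}(u)$ is the set of distinct simple reflections appearing in a reduced decomposition of $u$. An occurrence of a pattern $p\in\mathfrak{S}_k$ in $w$ is a subsequence $w(i_1)\cdots w(i_k)$, $i_1<\cdots<i_k$, in the same relative order as $p$; it is identified with its set of values $\{w(i_1),\dots,w(i_k)\}$, and is an $N$-occurrence if its largest value is $N$. For $w\in\mathfrak{S}_N$, $\overline{w}\in\mathfrak{S}_{N-1}$ is obtained by deleting the letter $N$ from the one-line notation of $w$. For $u\in\mathfrak{S}_n$ and $1\le k\le n-1$, $M_k(u)=\max\{u(1),\dots,u(k)\}$, $m_k(u)=\min\{u(k+1),\dots,u(n)\}$; write $M_k=M_k(\overline{w})$, $m_k=m_k(\overline{w})$. Let $\mathrm{newrep}(w)=\{k:\ s_k\in\mathrm{supp}(\overline{w}),\ w^{ -1}(N)\le k\}$. For $k\in\mathrm{newrep}(w)$ define: (I) if $w^{ -1}(N)<w^{ -1}(M_k)$, $\mathfrak{p}_k(w)=\{N,M_k,m_k\}$ (an $N$-occurrence of $321$); (II) if $w^{ -1}(N)>w^{ -1}(M_k)$ and $\overline{w}(k)>m_k$, $\mathfrak{p}_k(w)=\{N,\overline{w}(k),m_k\}$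 (an $N$-occurrence of $321$); (III) otherwise $\mathfrak{p}_k(w)=\{M_k,N,\overline{w}(k),m_k\}$ (an $N$-occurrence of $3412$). -}

module Defs where

open import Data.Nat using (ℕ; zero; suc; _+_; _∸_; _≤_; _<_; _⊔_; _⊓_; _≡ᵇ_; _<ᵇ_)
open import Data.Bool using (Bool; true; false; if_then_else_; _∧_)
open import Data.Fin using (Fin) renaming (_<_ to _<F_)
open import Data.Vec using (Vec; lookup; []; _∷_)
open import Data.List using (List; length; foldr; []; _∷_)
open import Data.List.Membership.Propositional using (_∈_)
open import Data.Product using (Σ; ∃; _×_; _,_)
open import Function.Bundles using (_⇔_)
open import Relation.Binary.PropositionalEquality using (_≡_)

-- Permutations of {1,…,n}, encoded by their one-line notation as a
-- function ℕ → ℕ (positions and values are 1-based; values of the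
-- function outside 1..n are irrelevant).

IsPerm : ℕ → (ℕ → ℕ) → Set
IsPerm n u =
  (∀ i → 1 ≤ i → i ≤ n → 1 ≤ u i × u i ≤ n) ×
  (∀ i j → 1 ≤ i → i ≤ n → 1 ≤ j → j ≤ n → u i ≡ u j → i ≡ j)

posOf : (ℕ → ℕ) → ℕ → ℕ → ℕ
posOf u zero    v = 0
posOf u (suc n) v = if u (suc n) ≡ᵇ v then suc n else posOf u n v

s : ℕ → ℕ → ℕ
s k i = if i ≡ᵇ k then suc k else (if i ≡ᵇ suc k then k else i)

wordProd : List ℕ → ℕ → ℕ
wordProd = foldr (λ a f i → s a (f i)) (λ i → i)

ValidWord : ℕ → List ℕ → Set
ValidWord n ws = ∀ a → a ∈ ws → 1 ≤ a × suc a ≤ n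

Decomp : ℕ → (ℕ → ℕ) → List ℕ → Set
Decomp n u ws = ValidWord n ws × (∀ i → 1 ≤ i → i ≤ n → wordProd ws i ≡ u i)

Reduced : ℕ → (ℕ → ℕ) → List ℕ → Set
Reduced n u ws = Decomp n u ws × (∀ vs → Decomp n u vs → length ws ≤ length vs)

InSupp : ℕ → (ℕ → ℕ) → ℕ → Set
InSupp n u k = Σ (List ℕ) λ ws → Reduced n u ws × k ∈ ws

-- w̄ : delete the letter N (at position q = w⁻¹(N)) from w

wbar : (ℕ → ℕ) → ℕ → ℕ → ℕ
wbar w q i = if i <ᵇ q then w i else w (suc i)

Mx : (ℕ → ℕ) → ℕ → ℕ
Mx u zero    = 0
Mx u (suc k) = Mx u k ⊔ u (suc k)

mnAux : (ℕ → ℕ) → ℕ → ℕ → ℕ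
mnAux u k zero    = u (suc k)
mnAux u k (suc d) = mnAux u k d ⊓ u (suc k + suc d)

-- m_k(u) = min{u(k+1),…,u(n)}  (for u ∈ 𝔖_n, 1 ≤ k ≤ n-1)
mn : ℕ → (ℕ → ℕ) → ℕ → ℕ
mn n u k = mnAux u k (n ∸ suc k)

qpos : ℕ → (ℕ → ℕ) → ℕ
qpos N w = posOf w N N

w̄ : ℕ → (ℕ → ℕ) → ℕ → ℕ
w̄ N w = wbar w (qpos N w)

InNewrep : ℕ → (ℕ → ℕ) → ℕ → Set
InNewrep N w k = InSupp (N ∸ 1) (w̄ N w) k × qpos N w ≤ k

-- 𝔭_k(w), as a list of its values (a set)
𝔭 : ℕ → (ℕ → ℕ) → ℕ → List ℕ
𝔭 N w k =
  let q  = qpos N w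
      Mk = Mx (w̄ N w) k
      mk = mn (N ∸ 1) (w̄ N w) k
      wk = w̄ N w k
      pM = posOf w N Mk
  in if q <ᵇ pM then N ∷ Mk ∷ mk ∷ []                              -- (I)
     else if (pM <ᵇ q) ∧ (mk <ᵇ wk) then N ∷ wk ∷ mk ∷ []           -- (II)
     else Mk ∷ N ∷ wk ∷ mk ∷ []                                     -- (III)

-- A pattern p ∈ 𝔖_k is given in one-line
-- notation as a Vec ℕ k; an occurrence in w ∈ 𝔖_N is a strictly
-- increasing choice of positions ι(0) < ⋯ < ι(k-1) in 1..N with
-- w(ι a) < w(ι b) ⇔ p(a) < p(b).

Occurrence : ℕ → (ℕ → ℕ) → {k : ℕ} → Vec ℕ k → (Fin k → ℕ) → Set
Occurrence N w {k} p ι =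
  (∀ a → 1 ≤ ι a × ι a ≤ N) ×
  (∀ a b → a <F b → ι a < ι b) ×
  (∀ a b → (lookup p a < lookup p b) ⇔ (w (ι a) < w (ι b)))

NOccurrence : ℕ → (ℕ → ℕ) → {k : ℕ} → Vec ℕ k → (Fin k → ℕ) → Set
NOccurrence N w {k} p ι =
  Occurrence N w p ι × (∃ λ a → w (ι a) ≡ N) × (∀ b → w (ι b) ≤ N)

HasNOcc : ℕ → (ℕ → ℕ) → {k : ℕ} → Vec ℕ k → Set
HasNOcc N w {k} p = ∃ λ (ι : Fin k → ℕ) → NOccurrence N w p ι

ValuesEq : (ℕ → ℕ) → {k : ℕ} → (Fin k → ℕ) → List ℕ → Set
ValuesEq w {k} ι xs = ∀ x → (∃ λ a → w (ι a) ≡ x) ⇔ (x ∈ xs)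

p45231 p45132 p43512 p34512 p35412 p45123 p45213 : Vec ℕ 5
p45231 = 4 ∷ 5 ∷ 2 ∷ 3 ∷ 1 ∷ []
p45132 = 4 ∷ 5 ∷ 1 ∷ 3 ∷ 2 ∷ []
p43512 = 4 ∷ 3 ∷ 5 ∷ 1 ∷ 2 ∷ []
p34512 = 3 ∷ 4 ∷ 5 ∷ 1 ∷ 2 ∷ []
p35412 = 3 ∷ 5 ∷ 4 ∷ 1 ∷ 2 ∷ []
p45123 = 4 ∷ 5 ∷ 1 ∷ 2 ∷ 3 ∷ []
p45213 = 4 ∷ 5 ∷ 2 ∷ 1 ∷ 3 ∷ []

p3412 : Vec ℕ 4
p3412 = 3 ∷ 4 ∷ 1 ∷ 2 ∷ []

-- Let b N a c be an N-occurrence of 3412 at positions i₁ < i₂ < i₃ < i₄ and put k = i₃ − 1.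
-- Any value above b to the left of i₃ (other than N), or below c to the right of i₃, would
-- complete the occurrence to one of the seven excluded patterns.  Hence, in w̄, the prefix of
-- length k has maximum M_k = b at position i₁ and the suffix has minimum m_k = c.  As b lies
-- left of N and w̄(k) = a < c, neither (I) nor (II) applies, and (III) gives 𝔭_k(w) = {b, N, a, c}.
-- Moreover the k values w̄(1), …, w̄(k) and c all lie in {1, …, b}, so k < b = w̄(i₁): w̄ moves
-- i₁ ≤ k beyond k, which puts s_k into every reduced word of w̄.

module Submission where

open import Defs
open import Data.Bool.Base using (if_then_else_)
open import Data.Bool.Properties using (if-float)
open import Data.Fin using (#_)
open import Data.Fin.Base as Fin using (Fin; fromℕ; fromℕ<; toℕ)
open import Data.Fin.Properties as Fin using (pigeonhole; toℕ-fromℕ<; toℕ<n)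
open import Data.List.Base using (List; []; _∷_; _++_; [_]; length; reverse; applyDownFrom)
open import Data.List.Membership.Propositional using (_∈_; _∉_)
open import Data.List.Membership.Propositional.Properties using (∈-++⁻; ∈-applyDownFrom⁻)
open import Data.List.Properties using (unfold-reverse)
open import Data.List.Relation.Unary.All as All using (All; []; _∷_)
open import Data.List.Relation.Unary.Any using (here; there)
open import Data.List.Relation.Unary.Any.Properties using (reverse⁻)
open import Data.Nat.Base
open import Data.Nat.Properties
open import Data.List.Membership.DecPropositional _≟_ using (_∈?_)
open import Data.Product using (Σ; ∃; ∃₂; _×_; _,_; proj₁; proj₂; uncurry)
open import Data.Sum using (_⊎_; inj₁; inj₂)
open import Data.Vec.Base using (Vec; []; _∷_; lookup; map)
open import Data.Vec.Properties using (lookup-map)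
open import Data.Vec.Relation.Unary.All as VecAll using ([]; _∷_)
open import Data.Vec.Relation.Unary.Linked using (Linked; []; [-]; _∷_)
open import Data.Vec.Relation.Unary.Linked.Properties using (Linked⇒All; lookup⁺)
open import Function.Base using (_∘_)
open import Function.Bundles using (_⇔_; mk⇔; Equivalence)
open import Relation.Binary.Definitions using (tri<; tri≈; tri>)
open import Relation.Binary.PropositionalEquality
  using (_≡_; _≢_; refl; sym; trans; cong; subst; subst₂; module ≡-Reasoning)
open import Relation.Nullary using (¬_; Dec; yes; no; contradiction)
open import Relation.Nullary.Decidable using (True; toWitness; dec-true; dec-false; map′; _×-dec_)

data SwapView (k i : ℕ) : Set where
  at-k   : i ≡ k → SwapView k i
  at-1+k : i ≡ suc k → SwapView k i
  fixed  : i ≢ k → i ≢ suc k → SwapView k i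

swapView : ∀ k i → SwapView k i
swapView k i with i ≟ k | i ≟ suc k
... | yes i≡k | _         = at-k i≡k
... | no _    | yes i≡1+k = at-1+k i≡1+k
... | no i≢k  | no i≢1+k  = fixed i≢k i≢1+k

s-k : ∀ k → s k k ≡ suc k
s-k k rewrite dec-true (k ≟ k) refl = refl

s-1+k : ∀ k → s k (suc k) ≡ k
s-1+k k rewrite dec-false (suc k ≟ k) 1+n≢n | dec-true (suc k ≟ suc k) refl = refl

s-fixed : ∀ {k i} → i ≢ k → i ≢ suc k → s k i ≡ i
s-fixed {k} {i} i≢k i≢1+k rewrite dec-false (i ≟ k) i≢k | dec-false (i ≟ suc k) i≢1+k = refl

s-involutive : ∀ k i → s k (s k i) ≡ i
s-involutive k i with swapView k i
... | at-k refl          = trans (cong (s k) (s-k k)) (s-1+k k)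
... | at-1+k refl        = trans (cong (s k) (s-1+k k)) (s-k k)
... | fixed i≢k i≢1+k    = trans (cong (s k) (s-fixed i≢k i≢1+k)) (s-fixed i≢k i≢1+k)

s-range : ∀ {n k i} → 1 ≤ k → suc k ≤ n → 1 ≤ i → i ≤ n → 1 ≤ s k i × s k i ≤ n
s-range {n} {k} {i} 1≤k 1+k≤n 1≤i i≤n with swapView k i
... | at-k refl       rewrite s-k k = s≤s z≤n , 1+k≤n
... | at-1+k refl     rewrite s-1+k k = 1≤k , <⇒≤ 1+k≤n
... | fixed i≢k i≢1+k rewrite s-fixed i≢k i≢1+k = 1≤i , i≤n

s-≤ : ∀ {k j i} → k ≢ j → i ≤ j → s k i ≤ j
s-≤ {k} {j} {i} k≢j i≤j with swapView k i
... | at-k refl       rewrite s-k k = ≤∧≢⇒< i≤j k≢j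
... | at-1+k refl     rewrite s-1+k k = ≤-trans (n≤1+n k) i≤j
... | fixed i≢k i≢1+k rewrite s-fixed i≢k i≢1+k = i≤j

ValidWord-tail : ∀ {n a ws} → ValidWord n (a ∷ ws) → ValidWord n ws
ValidWord-tail valid b = valid b ∘ there

wordProd-++ : ∀ xs ys i → wordProd (xs ++ ys) i ≡ wordProd xs (wordProd ys i)
wordProd-++ []       ys i = refl
wordProd-++ (a ∷ xs) ys i = cong (s a) (wordProd-++ xs ys i)

wordProd-injective : ∀ ws {x y} → wordProd ws x ≡ wordProd ws y → x ≡ y
wordProd-injective []       eq = eq
wordProd-injective (a ∷ ws) {x} {y} eq = wordProd-injective ws (begin
  wordProd ws x             ≡⟨ s-involutive a _ ⟨
  s a (wordProd (a ∷ ws) x) ≡⟨ cong (s a) eq ⟩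
  s a (wordProd (a ∷ ws) y) ≡⟨ s-involutive a _ ⟩
  wordProd ws y             ∎)
  where open ≡-Reasoning

wordProd-reverse : ∀ ws x → wordProd (reverse ws) (wordProd ws x) ≡ x
wordProd-reverse []       x = refl
wordProd-reverse (a ∷ ws) x = begin
  wordProd (reverse (a ∷ ws)) y            ≡⟨ cong (λ vs → wordProd vs y) (unfold-reverse a ws) ⟩
  wordProd (reverse ws ++ [ a ]) y         ≡⟨ wordProd-++ (reverse ws) [ a ] y ⟩
  wordProd (reverse ws) (s a y)            ≡⟨ cong (wordProd (reverse ws)) (s-involutive a _) ⟩
  wordProd (reverse ws) (wordProd ws x)    ≡⟨ wordProd-reverse ws x ⟩
  x                                        ∎
  where
  open ≡-Reasoning
  y = s a (wordProd ws x)

wordProd-range : ∀ {n i} ws → ValidWord n ws → 1 ≤ i → i ≤ n →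
                 1 ≤ wordProd ws i × wordProd ws i ≤ n
wordProd-range []       _     1≤i i≤n = 1≤i , i≤n
wordProd-range (a ∷ ws) valid 1≤i i≤n =
  let 1≤a , 1+a≤n = valid a (here refl)
      1≤x , x≤n   = wordProd-range ws (ValidWord-tail valid) 1≤i i≤n
  in s-range 1≤a 1+a≤n 1≤x x≤n

wordProd-fixes-1+n : ∀ {n} ws → ValidWord n ws → wordProd ws (suc n) ≡ suc n
wordProd-fixes-1+n []       _     = refl
wordProd-fixes-1+n (a ∷ ws) valid
  rewrite wordProd-fixes-1+n ws (ValidWord-tail valid) =
  s-fixed (λ 1+n≡a → <⇒≱ 1+a≤n (≤-trans (n≤1+n _) (≤-reflexive 1+n≡a)))
          (λ 1+n≡1+a → <⇒≱ 1+a≤n (≤-reflexive (suc-injective 1+n≡1+a)))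
  where 1+a≤n = proj₂ (valid a (here refl))

wordProd-≤ : ∀ {k i} ws → k ∉ ws → i ≤ k → wordProd ws i ≤ k
wordProd-≤ []       _   i≤k = i≤k
wordProd-≤ (a ∷ ws) k∉ i≤k =
  s-≤ (λ a≡k → k∉ (here (sym a≡k))) (wordProd-≤ ws (k∉ ∘ there) i≤k)

cycleWord : ℕ → ℕ → List ℕ
cycleWord v d = applyDownFrom (v +_) d

cycleWord-moves : ∀ v d → wordProd (cycleWord v d) v ≡ v + d
cycleWord-moves v zero    = sym (+-identityʳ v)
cycleWord-moves v (suc d) = begin
  s (v + d) (wordProd (cycleWord v d) v) ≡⟨ cong (s (v + d)) (cycleWord-moves v d) ⟩
  s (v + d) (v + d)                      ≡⟨ s-k (v + d) ⟩
  suc (v + d)                            ≡⟨ +-suc v d ⟨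
  v + suc d                              ∎
  where open ≡-Reasoning

cycleWord-letters : ∀ {v d a} → a ∈ cycleWord v d → v ≤ a × suc a ≤ v + d
cycleWord-letters {v} a∈ with _ , i<d , refl ← ∈-applyDownFrom⁻ (v +_) a∈ =
  m≤m+n v _ , +-monoʳ-< v i<d

-- The cycle c sends u(m+1) to m+1, so c ∘ u fixes m+1 and u = c⁻¹ ∘ (c ∘ u).
decomposition : ∀ n u → IsPerm n u → Σ (List ℕ) (Decomp n u)
decomposition zero    u _ = [] , (λ _ ()) , λ _ 1≤i i≤0 → contradiction (≤-trans 1≤i i≤0) λ ()
decomposition (suc m) u (u-range , u-injective) = reverse cycle ++ ws′ , valid , correct
  where
  v       = u (suc m)
  v-range = u-range (suc m) (s≤s z≤n) ≤-refl
  cycle   = cycleWord v (suc m ∸ v)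
  c       = wordProd cycle

  c-v : c v ≡ suc m
  c-v = trans (cycleWord-moves v _) (m+[n∸m]≡n (proj₂ v-range))

  cycle-valid : ValidWord (suc m) cycle
  cycle-valid a a∈ =
    let v≤a , 1+a≤v+d = cycleWord-letters a∈
    in ≤-trans (proj₁ v-range) v≤a , ≤-trans 1+a≤v+d (≤-reflexive (m+[n∸m]≡n (proj₂ v-range)))

  u′ : ℕ → ℕ
  u′ = c ∘ u

  u′-perm : IsPerm m u′
  u′-perm = range , λ i j 1≤i i≤m 1≤j j≤m eq →
    u-injective i j 1≤i (m≤n⇒m≤1+n i≤m) 1≤j (m≤n⇒m≤1+n j≤m) (wordProd-injective cycle eq)
    where
    range : ∀ i → 1 ≤ i → i ≤ m → 1 ≤ u′ i × u′ i ≤ m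
    range i 1≤i i≤m =
      let 1≤ui , ui≤1+m = u-range i 1≤i (m≤n⇒m≤1+n i≤m)
          1≤u′i , u′i≤1+m = wordProd-range cycle cycle-valid 1≤ui ui≤1+m
          u′i≢1+m : u′ i ≢ suc m
          u′i≢1+m eq = <⇒≢ (s≤s i≤m)
            (u-injective i (suc m) 1≤i (m≤n⇒m≤1+n i≤m) (s≤s z≤n) ≤-refl
              (wordProd-injective cycle (trans eq (sym c-v))))
      in 1≤u′i , ≤-pred (≤∧≢⇒< u′i≤1+m u′i≢1+m)

  ws′ = proj₁ (decomposition m u′ u′-perm)
  ws′-valid = proj₁ (proj₂ (decomposition m u′ u′-perm))
  ws′-correct = proj₂ (proj₂ (decomposition m u′ u′-perm))

  valid : ValidWord (suc m) (reverse cycle ++ ws′)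
  valid a a∈ with ∈-++⁻ (reverse cycle) a∈
  ... | inj₁ a∈cycle = cycle-valid a (reverse⁻ a∈cycle)
  ... | inj₂ a∈ws′   = let 1≤a , 1+a≤m = ws′-valid a a∈ws′ in 1≤a , m≤n⇒m≤1+n 1+a≤m

  ws′-correct′ : ∀ i → 1 ≤ i → i ≤ suc m → wordProd ws′ i ≡ u′ i
  ws′-correct′ i 1≤i i≤1+m with m≤n⇒m<n∨m≡n i≤1+m
  ... | inj₁ i<1+m = ws′-correct i 1≤i (≤-pred i<1+m)
  ... | inj₂ refl  = trans (wordProd-fixes-1+n ws′ ws′-valid) (sym c-v)

  correct : ∀ i → 1 ≤ i → i ≤ suc m → wordProd (reverse cycle ++ ws′) i ≡ u i
  correct i 1≤i i≤1+m = begin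
    wordProd (reverse cycle ++ ws′) i ≡⟨ wordProd-++ (reverse cycle) ws′ i ⟩
    c⁻¹ (wordProd ws′ i)              ≡⟨ cong c⁻¹ (ws′-correct′ i 1≤i i≤1+m) ⟩
    c⁻¹ (c (u i))                     ≡⟨ wordProd-reverse cycle (u i) ⟩
    u i                               ∎
    where
    open ≡-Reasoning
    c⁻¹ = wordProd (reverse cycle)

validWord? : ∀ n ws → Dec (ValidWord n ws)
validWord? n ws = map′ (λ all a → All.lookup all) (λ valid → All.tabulate (valid _))
  (All.all? (λ a → 1 ≤? a ×-dec suc a ≤? n) ws)

agreeOn? : ∀ n (f g : ℕ → ℕ) → Dec (∀ i → 1 ≤ i → i ≤ n → f i ≡ g i)
agreeOn? n f g = map′ to from (allUpTo? (λ j → f (suc j) ≟ g (suc j)) n)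
  where
  to : (∀ {j} → j < n → f (suc j) ≡ g (suc j)) → ∀ i → 1 ≤ i → i ≤ n → f i ≡ g i
  to agree (suc j) _ j<n = agree j<n
  from : (∀ i → 1 ≤ i → i ≤ n → f i ≡ g i) → ∀ {j} → j < n → f (suc j) ≡ g (suc j)
  from agree j<n = agree _ (s≤s z≤n) j<n

decomp? : ∀ n u ws → Dec (Decomp n u ws)
decomp? n u ws = validWord? n ws ×-dec agreeOn? n (wordProd ws) u

ShortWord : ℕ → ℕ → (List ℕ → Set) → Set
ShortWord B ℓ P = ∃ λ ws → length ws ≤ ℓ × All (_< B) ws × P ws

shortWord? : ∀ B ℓ (P : List ℕ → Set) → (∀ ws → Dec (P ws)) → Dec (ShortWord B ℓ P)
shortWord? B ℓ P P? with P? []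
... | yes p = yes ([] , z≤n , [] , p)
shortWord? B zero    P P? | no ¬p = no λ { ([] , _ , _ , p) → ¬p p }
shortWord? B (suc ℓ) P P? | no ¬p
  with anyUpTo? (λ a → shortWord? B ℓ (P ∘ (a ∷_)) (P? ∘ (a ∷_))) B
... | yes (a , a<B , ws , len , ws<B , p) = yes (a ∷ ws , s≤s len , a<B ∷ ws<B , p)
... | no ¬short = no λ
  { ([] , _ , _ , p) → ¬p p
  ; (a ∷ ws , s≤s len , a<B ∷ ws<B , p) → ¬short (a , a<B , ws , len , ws<B , p) }

shortest : ∀ B (P : List ℕ → Set) → (∀ ws → Dec (P ws)) → (∀ {ws} → P ws → All (_< B) ws) →
           ∀ ws → P ws → ∃ λ vs → P vs × (∀ us → P us → length vs ≤ length us)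
shortest B P P? letters ws = within (length ws) ws ≤-refl
  where
  within : ∀ L ws → length ws ≤ L → P ws →
           ∃ λ vs → P vs × (∀ us → P us → length vs ≤ length us)
  within _       []       _         p = [] , p , λ _ _ → z≤n
  within (suc L) (a ∷ ws) (s≤s len) p with shortWord? B (length ws) P P?
  ... | yes (vs , len′ , _ , q) = within L vs (≤-trans len′ len) q
  ... | no ¬shorter = a ∷ ws , p , minimal
    where
    minimal : ∀ us → P us → length (a ∷ ws) ≤ length us
    minimal us q with length ws <? length us
    ... | yes longer  = longer
    ... | no ¬longer  = contradiction (us , ≮⇒≥ ¬longer , letters q , q) ¬shorter

reducedWord : ∀ {n u} → IsPerm n u → Σ (List ℕ) (Reduced n u)
reducedWord {n} {u} u-perm =
  let ws , d = decomposition n u u-perm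
  in shortest n (Decomp n u) (decomp? n u) (λ d → All.tabulate (proj₂ ∘ proj₁ d _)) ws d

-- Words without s_k preserve {1,…,k}, so a permutation moving some i ≤ k beyond k needs s_k.
crossing⇒InSupp : ∀ {n u k i} → IsPerm n u → 1 ≤ i → i ≤ n → i ≤ k → k < u i → InSupp n u k
crossing⇒InSupp {n} {u} {k} {i} u-perm 1≤i i≤n i≤k k<ui with reducedWord u-perm
... | ws , reduced with k ∈? ws
...   | yes k∈ = ws , reduced , k∈
...   | no k∉  = contradiction
  (subst (_≤ k) (proj₂ (proj₁ reduced) i 1≤i i≤n) (wordProd-≤ ws k∉ i≤k)) (<⇒≱ k<ui)

pigeonhole-ℕ : ∀ {k b} (g : ℕ → ℕ) → (∀ {i} → i ≤ k → 1 ≤ g i × g i ≤ b) →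
               (∀ {i j} → i ≤ k → j ≤ k → g i ≡ g j → i ≡ j) → k < b
pigeonhole-ℕ {k} {b} g range injective with k <? b
... | yes k<b = k<b
... | no k≮b = contradiction (pigeonhole (s≤s (≮⇒≥ k≮b)) f) no-collision
  where
  toℕ≤k : (x : Fin (suc k)) → toℕ x ≤ k
  toℕ≤k x = ≤-pred (toℕ<n x)
  f : Fin (suc k) → Fin b
  f x = let 1≤gx , gx≤b = range (toℕ≤k x) in fromℕ< (∸-monoˡ-< (s≤s gx≤b) 1≤gx)
  no-collision : ¬ ∃₂ λ i j → i Fin.< j × f i ≡ f j
  no-collision (i , j , i<j , fi≡fj) = <⇒≢ i<j (injective (toℕ≤k i) (toℕ≤k j)
    (∸-cancelʳ-≡ (proj₁ (range (toℕ≤k i))) (proj₁ (range (toℕ≤k j)))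
      (trans (sym (toℕ-fromℕ< _)) (trans (cong toℕ fi≡fj) (toℕ-fromℕ< _)))))

-- Pigeonhole on the k + 1 positions 1, …, k, j.
prefix-bound : ∀ {n u k j b} → IsPerm n u → (∀ i → 1 ≤ i → i ≤ k → u i ≤ b) →
               k < j → j ≤ n → u j ≤ b → k < b
prefix-bound {n} {u} {k} {j} {b} (u-range , u-injective) prefix≤b k<j j≤n uj≤b =
  pigeonhole-ℕ (u ∘ pos) range injective
  where
  pos : ℕ → ℕ
  pos x = if x <ᵇ k then suc x else j

  pos-cases : ∀ {x} → x ≤ k → (x < k × pos x ≡ suc x) ⊎ (x ≡ k × pos x ≡ j)
  pos-cases {x} x≤k with x <? k
  ... | yes x<k rewrite dec-true (x <? k) x<k = inj₁ (x<k , refl)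
  ... | no x≮k  rewrite dec-false (x <? k) x≮k = inj₂ (≤-antisym x≤k (≮⇒≥ x≮k) , refl)

  pos-range : ∀ {x} → x ≤ k → 1 ≤ pos x × pos x ≤ n
  pos-range x≤k with pos-cases x≤k
  ... | inj₁ (x<k , eq) rewrite eq = s≤s z≤n , ≤-trans x<k (≤-trans (<⇒≤ k<j) j≤n)
  ... | inj₂ (_ , eq)   rewrite eq = ≤-trans (s≤s z≤n) k<j , j≤n

  range : ∀ {x} → x ≤ k → 1 ≤ u (pos x) × u (pos x) ≤ b
  range {x} x≤k with pos-cases x≤k
  ... | inj₁ (x<k , eq) rewrite eq =
    proj₁ (u-range _ (s≤s z≤n) (≤-trans x<k (≤-trans (<⇒≤ k<j) j≤n))) ,
    prefix≤b (suc x) (s≤s z≤n) x<k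
  ... | inj₂ (_ , eq)   rewrite eq = proj₁ (u-range j (≤-trans (s≤s z≤n) k<j) j≤n) , uj≤b

  injective : ∀ {x y} → x ≤ k → y ≤ k → u (pos x) ≡ u (pos y) → x ≡ y
  injective {x} {y} x≤k y≤k eq
    with u-injective _ _ (proj₁ (pos-range x≤k)) (proj₂ (pos-range x≤k))
                         (proj₁ (pos-range y≤k)) (proj₂ (pos-range y≤k)) eq
  ... | pos-eq with pos-cases x≤k | pos-cases y≤k
  ...   | inj₁ (_ , px) | inj₁ (_ , py) = suc-injective (trans (sym px) (trans pos-eq py))
  ...   | inj₂ (x≡k , _) | inj₂ (y≡k , _) = trans x≡k (sym y≡k)
  ...   | inj₁ (x<k , px) | inj₂ (_ , py) =
    contradiction (trans (sym px) (trans pos-eq py)) (<⇒≢ (≤-<-trans x<k k<j))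
  ...   | inj₂ (_ , px) | inj₁ (y<k , py) =
    contradiction (trans (sym py) (trans (sym pos-eq) px)) (<⇒≢ (≤-<-trans y<k k<j))

posOf-inverse : ∀ {N w} → IsPerm N w → ∀ {m p} → m ≤ N → 1 ≤ p → p ≤ m → posOf w m (w p) ≡ p
posOf-inverse _ {zero} _ 1≤p p≤0 = contradiction (≤-trans 1≤p p≤0) λ ()
posOf-inverse {N} {w} w-perm@(_ , w-injective) {suc m} {p} 1+m≤N 1≤p p≤1+m
  with m≤n⇒m<n∨m≡n p≤1+m
... | inj₂ refl rewrite dec-true (w (suc m) ≟ w (suc m)) refl = refl
... | inj₁ p<1+m with w (suc m) ≟ w p
...   | yes eq = contradiction
  (w-injective _ _ (s≤s z≤n) 1+m≤N 1≤p (≤-trans (<⇒≤ p<1+m) 1+m≤N) eq) (>⇒≢ p<1+m)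
...   | no w1+m≢wp rewrite dec-false (w (suc m) ≟ w p) w1+m≢wp =
  posOf-inverse w-perm (<⇒≤ 1+m≤N) 1≤p (≤-pred p<1+m)

punchIn : ℕ → ℕ → ℕ
punchIn q i = if i <ᵇ q then i else suc i

punchIn-< : ∀ {q i} → i < q → punchIn q i ≡ i
punchIn-< {q} {i} i<q rewrite dec-true (i <? q) i<q = refl

punchIn-≥ : ∀ {q i} → q ≤ i → punchIn q i ≡ suc i
punchIn-≥ {q} {i} q≤i rewrite dec-false (i <? q) (≤⇒≯ q≤i) = refl

punchIn-bounds : ∀ q i → i ≤ punchIn q i × punchIn q i ≤ suc i
punchIn-bounds q i with i <? q
... | yes i<q rewrite punchIn-< i<q = ≤-refl , n≤1+n i
... | no i≮q  rewrite punchIn-≥ (≮⇒≥ i≮q) = n≤1+n i , ≤-refl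

punchIn-≢ : ∀ q i → punchIn q i ≢ q
punchIn-≢ q i with i <? q
... | yes i<q rewrite punchIn-< i<q = <⇒≢ i<q
... | no i≮q  rewrite punchIn-≥ (≮⇒≥ i≮q) = >⇒≢ (s≤s (≮⇒≥ i≮q))

punchIn-injective : ∀ q {i j} → punchIn q i ≡ punchIn q j → i ≡ j
punchIn-injective q {i} {j} eq with i <? q | j <? q
... | yes i<q | yes j<q = trans (sym (punchIn-< i<q)) (trans eq (punchIn-< j<q))
... | no i≮q  | no j≮q  =
  suc-injective (trans (sym (punchIn-≥ (≮⇒≥ i≮q))) (trans eq (punchIn-≥ (≮⇒≥ j≮q))))
... | yes i<q | no j≮q  = contradiction
  (trans (sym (punchIn-< i<q)) (trans eq (punchIn-≥ (≮⇒≥ j≮q))))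
  (<⇒≢ (<-≤-trans i<q (≤-trans (≮⇒≥ j≮q) (n≤1+n j))))
... | no i≮q  | yes j<q = contradiction
  (trans (sym (punchIn-< j<q)) (trans (sym eq) (punchIn-≥ (≮⇒≥ i≮q))))
  (<⇒≢ (<-≤-trans j<q (≤-trans (≮⇒≥ i≮q) (n≤1+n i))))

wbar≡w∘punchIn : ∀ w q i → wbar w q i ≡ w (punchIn q i)
wbar≡w∘punchIn w q i = sym (if-float w (i <ᵇ q))

wbar-< : ∀ w {q i} → i < q → wbar w q i ≡ w i
wbar-< w {q} {i} i<q = trans (wbar≡w∘punchIn w q i) (cong w (punchIn-< i<q))

wbar-≥ : ∀ w {q i} → q ≤ i → wbar w q i ≡ w (suc i)
wbar-≥ w {q} {i} q≤i = trans (wbar≡w∘punchIn w q i) (cong w (punchIn-≥ q≤i))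

wbar-perm : ∀ {n w q} → IsPerm (suc n) w → 1 ≤ q → q ≤ suc n → w q ≡ suc n → IsPerm n (wbar w q)
wbar-perm {n} {w} {q} (w-range , w-injective) 1≤q q≤1+n wq≡1+n = range , injective
  where
  j-range : ∀ {i} → 1 ≤ i → i ≤ n → 1 ≤ punchIn q i × punchIn q i ≤ suc n
  j-range {i} 1≤i i≤n =
    let i≤j , j≤1+i = punchIn-bounds q i in ≤-trans 1≤i i≤j , ≤-trans j≤1+i (s≤s i≤n)

  range : ∀ i → 1 ≤ i → i ≤ n → 1 ≤ wbar w q i × wbar w q i ≤ n
  range i 1≤i i≤n rewrite wbar≡w∘punchIn w q i =
    let 1≤j , j≤1+n = j-range 1≤i i≤n
        1≤wj , wj≤1+n = w-range _ 1≤j j≤1+n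
        wj≢1+n : w (punchIn q i) ≢ suc n
        wj≢1+n eq = punchIn-≢ q i (w-injective _ q 1≤j j≤1+n 1≤q q≤1+n (trans eq (sym wq≡1+n)))
    in 1≤wj , ≤-pred (≤∧≢⇒< wj≤1+n wj≢1+n)

  injective : ∀ i j → 1 ≤ i → i ≤ n → 1 ≤ j → j ≤ n → wbar w q i ≡ wbar w q j → i ≡ j
  injective i j 1≤i i≤n 1≤j j≤n eq rewrite wbar≡w∘punchIn w q i | wbar≡w∘punchIn w q j =
    let 1≤i′ , i′≤1+n = j-range 1≤i i≤n
        1≤j′ , j′≤1+n = j-range 1≤j j≤n
    in punchIn-injective q (w-injective _ _ 1≤i′ i′≤1+n 1≤j′ j′≤1+n eq)

Mx-lub : ∀ u k {B} → (∀ i → 1 ≤ i → i ≤ k → u i ≤ B) → Mx u k ≤ B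
Mx-lub u zero    _     = z≤n
Mx-lub u (suc k) bound =
  ⊔-lub (Mx-lub u k λ i 1≤i i≤k → bound i 1≤i (m≤n⇒m≤1+n i≤k)) (bound (suc k) (s≤s z≤n) ≤-refl)

≤-Mx : ∀ u {k i} → 1 ≤ i → i ≤ k → u i ≤ Mx u k
≤-Mx u {zero}  1≤i i≤0 = contradiction (≤-trans 1≤i i≤0) λ ()
≤-Mx u {suc k} 1≤i i≤1+k with m≤n⇒m<n∨m≡n i≤1+k
... | inj₁ i<1+k = ≤-trans (≤-Mx u 1≤i (≤-pred i<1+k)) (m≤m⊔n _ _)
... | inj₂ refl  = m≤n⊔m _ _

Mx-attained : ∀ u {k p} → 1 ≤ p → p ≤ k → (∀ i → 1 ≤ i → i ≤ k → u i ≤ u p) → Mx u k ≡ u p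
Mx-attained u {k} 1≤p p≤k bound = ≤-antisym (Mx-lub u k bound) (≤-Mx u 1≤p p≤k)

mnAux-glb : ∀ u k d {B} → (∀ j → k < j → j ≤ suc k + d → B ≤ u j) → B ≤ mnAux u k d
mnAux-glb u k zero    bound = bound (suc k) ≤-refl (m≤m+n (suc k) 0)
mnAux-glb u k (suc d) bound = ⊓-glb
  (mnAux-glb u k d λ j k<j j≤ → bound j k<j (≤-trans j≤ (+-monoʳ-≤ (suc k) (n≤1+n d))))
  (bound (suc k + suc d) (s≤s (m≤m+n k (suc d))) ≤-refl)

mnAux-≤ : ∀ u k d {j} → k < j → j ≤ suc k + d → mnAux u k d ≤ u j
mnAux-≤ u k zero    {j} k<j j≤ =
  ≤-reflexive (cong u (≤-antisym k<j (subst (j ≤_) (+-identityʳ (suc k)) j≤)))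
mnAux-≤ u k (suc d) {j} k<j j≤ with m≤n⇒m<n∨m≡n j≤
... | inj₁ j< =
  ≤-trans (m⊓n≤m _ _) (mnAux-≤ u k d k<j (≤-pred (subst (j <_) (+-suc (suc k) d) j<)))
... | inj₂ refl = m⊓n≤n _ _

mn-attained : ∀ n u {k p} → suc k ≤ n → k < p → p ≤ n → (∀ j → k < j → j ≤ n → u p ≤ u j) →
              mn n u k ≡ u p
mn-attained n u {k} 1+k≤n k<p p≤n bound = ≤-antisym
  (mnAux-≤ u k _ k<p (subst (_ ≤_) (sym 1+k+d≡n) p≤n))
  (mnAux-glb u k _ λ j k<j j≤ → bound j k<j (subst (j ≤_) 1+k+d≡n j≤))
  where
  1+k+d≡n : suc k + (n ∸ suc k) ≡ n
  1+k+d≡n = m+[n∸m]≡n 1+k≤n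

-- 1-based indexing, with junk value 0 outside 1,…,k.
_⟨_⟩ : ∀ {k} → Vec ℕ k → ℕ → ℕ
[]       ⟨ _ ⟩           = 0
(_ ∷ _)  ⟨ zero ⟩        = 0
(v ∷ _)  ⟨ suc zero ⟩    = v
(_ ∷ vs) ⟨ suc (suc r) ⟩ = vs ⟨ suc r ⟩

⟨⟩-bounded : ∀ {k B} {vs : Vec ℕ k} → VecAll.All (B <_) vs →
             ∀ {r} → 1 ≤ r → r ≤ k → B < vs ⟨ r ⟩
⟨⟩-bounded (B<v ∷ _)   {suc zero}    _ _       = B<v
⟨⟩-bounded (_ ∷ B<vs)  {suc (suc r)} _ 2+r≤1+k = ⟨⟩-bounded B<vs (s≤s z≤n) (≤-pred 2+r≤1+k)

⟨⟩-increasing : ∀ {k} {vs : Vec ℕ k} → Linked _<_ vs →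
                ∀ {x y} → 1 ≤ x → x < y → y ≤ k → vs ⟨ x ⟩ < vs ⟨ y ⟩
⟨⟩-increasing {vs = _ ∷ _ ∷ _} (v<v′ ∷ linked) {suc zero}    {suc (suc y)} _ _ y≤ =
  ⟨⟩-bounded (Linked⇒All <-trans v<v′ linked) (s≤s z≤n) (≤-pred y≤)
⟨⟩-increasing {vs = _ ∷ _ ∷ _} (_ ∷ linked)    {suc (suc x)} {suc (suc y)} _ x<y y≤ =
  ⟨⟩-increasing linked (s≤s z≤n) (≤-pred x<y) (≤-pred y≤)
⟨⟩-increasing [-] {suc zero} {suc (suc y)} _ _ (s≤s ())
⟨⟩-increasing [-] {suc (suc x)} {suc (suc y)} _ _ (s≤s ())
⟨⟩-increasing _ {suc _} {suc zero} _ (s≤s ()) _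

head≤lookup : ∀ {k} {ps : Vec ℕ (suc k)} → Linked _<_ ps →
              ∀ a → lookup ps Fin.zero ≤ lookup ps a
head≤lookup _ Fin.zero = ≤-refl
head≤lookup {ps = _ ∷ _ ∷ _} (p<p′ ∷ ps↑) (Fin.suc a) = ≤-trans (<⇒≤ p<p′) (head≤lookup ps↑ a)

lookup≤last : ∀ {k} {ps : Vec ℕ (suc k)} → Linked _<_ ps →
              ∀ a → lookup ps a ≤ lookup ps (fromℕ k)
lookup≤last {zero}  _ Fin.zero = ≤-refl
lookup≤last {suc k} {_ ∷ _ ∷ _} (p<p′ ∷ ps↑) Fin.zero =
  ≤-trans (<⇒≤ p<p′) (lookup≤last ps↑ Fin.zero)
lookup≤last {suc k} {_ ∷ _ ∷ _} (_ ∷ ps↑) (Fin.suc a) = lookup≤last ps↑ a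

lookup-map-≡ : ∀ {k} {f g : ℕ → ℕ} {xs ys : Vec ℕ k} → map f xs ≡ map g ys →
               ∀ a → f (lookup xs a) ≡ g (lookup ys a)
lookup-map-≡ {f = f} {g} {xs} {ys} eq a =
  trans (sym (lookup-map a f xs)) (trans (cong (λ zs → lookup zs a) eq) (lookup-map a g ys))

RankVector : ∀ {k} → Vec ℕ (suc k) → Set
RankVector {k} P = (∀ a → 1 ≤ lookup P a × lookup P a ≤ suc k) × ∃ λ a → lookup P a ≡ suc k

rankVector? : ∀ {k} (P : Vec ℕ (suc k)) → Dec (RankVector P)
rankVector? {k} P =
  Fin.all? (λ a → 1 ≤? lookup P a ×-dec lookup P a ≤? suc k) ×-dec
  Fin.any? (λ a → lookup P a ≟ suc k)

-- An occurrence is described by its positions ps and its values vs, both listed in increasing order.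
occurrence-by-ranks : ∀ {N w k} (P : Vec ℕ (suc k)) (ps vs : Vec ℕ (suc k)) →
  (∀ a → 1 ≤ lookup P a × lookup P a ≤ suc k) →
  1 ≤ lookup ps Fin.zero → lookup ps (fromℕ k) ≤ N → Linked _<_ ps → Linked _<_ vs →
  map w ps ≡ map (vs ⟨_⟩) P → Occurrence N w P (lookup ps)
occurrence-by-ranks {N} {w} P ps vs ranks 1≤p₀ pₖ≤N ps↑ vs↑ w∘ps≡vs∘P =
  range , increasing , order
  where
  range : ∀ a → 1 ≤ lookup ps a × lookup ps a ≤ N
  range a = ≤-trans 1≤p₀ (head≤lookup ps↑ a) , ≤-trans (lookup≤last ps↑ a) pₖ≤N

  increasing : ∀ a b → a Fin.< b → lookup ps a < lookup ps b
  increasing a b = lookup⁺ <-trans ps↑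

  ranked : ∀ {a b} → lookup P a < lookup P b → vs ⟨ lookup P a ⟩ < vs ⟨ lookup P b ⟩
  ranked {a} {b} Pa<Pb = ⟨⟩-increasing vs↑ (proj₁ (ranks a)) Pa<Pb (proj₂ (ranks b))

  order : ∀ a b → (lookup P a < lookup P b) ⇔ (w (lookup ps a) < w (lookup ps b))
  order a b rewrite lookup-map-≡ w∘ps≡vs∘P a | lookup-map-≡ w∘ps≡vs∘P b = mk⇔ ranked reflect
    where
    reflect : vs ⟨ lookup P a ⟩ < vs ⟨ lookup P b ⟩ → lookup P a < lookup P b
    reflect v<v′ with <-cmp (lookup P a) (lookup P b)
    ... | tri< Pa<Pb _ _ = Pa<Pb
    ... | tri≈ _ Pa≡Pb _ = contradiction v<v′ (<-irrefl (cong (vs ⟨_⟩) Pa≡Pb))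
    ... | tri> _ _ Pb<Pa = contradiction (ranked Pb<Pa) (<⇒≯ v<v′)

nOccurrence-by-ranks : ∀ {N w k} → IsPerm N w → (P : Vec ℕ (suc k)) → {True (rankVector? P)} →
  (ps vs : Vec ℕ (suc k)) → 1 ≤ lookup ps Fin.zero → lookup ps (fromℕ k) ≤ N →
  Linked _<_ ps → Linked _<_ vs → vs ⟨ suc k ⟩ ≡ N → map w ps ≡ map (vs ⟨_⟩) P → HasNOcc N w P
nOccurrence-by-ranks {N} {w} {k} (w-range , _) P {isRank} ps vs 1≤p₀ pₖ≤N ps↑ vs↑ top≡N w∘ps≡vs∘P
  with ranks , a , Pa≡1+k ← toWitness isRank =
  lookup ps , occurrence , (a , attains-N) , λ b → proj₂ (uncurry (w-range _) (proj₁ occurrence b))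
  where
  occurrence = occurrence-by-ranks P ps vs ranks 1≤p₀ pₖ≤N ps↑ vs↑ w∘ps≡vs∘P
  attains-N : w (lookup ps a) ≡ N
  attains-N = trans (lookup-map-≡ w∘ps≡vs∘P a) (trans (cong (vs ⟨_⟩) Pa≡1+k) top≡N)

𝔭-caseIII : ∀ N w k → posOf w N (Mx (w̄ N w) k) < qpos N w → w̄ N w k ≤ mn (N ∸ 1) (w̄ N w) k →
            𝔭 N w k ≡ Mx (w̄ N w) k ∷ N ∷ w̄ N w k ∷ mn (N ∸ 1) (w̄ N w) k ∷ []
𝔭-caseIII N w k pM<q wk≤mk
  rewrite dec-false (qpos N w <? posOf w N (Mx (w̄ N w) k)) (<⇒≯ pM<q)
        | dec-true (posOf w N (Mx (w̄ N w) k) <? qpos N w) pM<q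
        | dec-false (mn (N ∸ 1) (w̄ N w) k <? w̄ N w k) (≤⇒≯ wk≤mk) = refl

module Occurrence3412
  (n : ℕ) (w : ℕ → ℕ) (w-perm : IsPerm (suc n) w)
  (avoid45231 : ¬ HasNOcc (suc n) w p45231) (avoid45132 : ¬ HasNOcc (suc n) w p45132)
  (avoid43512 : ¬ HasNOcc (suc n) w p43512) (avoid34512 : ¬ HasNOcc (suc n) w p34512)
  (avoid35412 : ¬ HasNOcc (suc n) w p35412) (avoid45123 : ¬ HasNOcc (suc n) w p45123)
  (avoid45213 : ¬ HasNOcc (suc n) w p45213)
  (ι : Fin 4 → ℕ) (occ : NOccurrence (suc n) w p3412 ι)
  where

  i₁ i₂ i₃ i₄ : ℕ
  i₁ = ι (# 0)
  i₂ = ι (# 1)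
  i₃ = ι (# 2)
  i₄ = ι (# 3)

  b a c : ℕ
  b = w i₁
  a = w i₃
  c = w i₄

  private
    ι-range      = proj₁ (proj₁ occ)
    ι-increasing = proj₁ (proj₂ (proj₁ occ))
    ι-order      = proj₂ (proj₂ (proj₁ occ))
    w-range      = proj₁ w-perm
    w-injective  = proj₂ w-perm

  i₁<i₂ : i₁ < i₂
  i₁<i₂ = ι-increasing (# 0) (# 1) z<s
  i₂<i₃ : i₂ < i₃
  i₂<i₃ = ι-increasing (# 1) (# 2) (s<s z<s)
  i₃<i₄ : i₃ < i₄
  i₃<i₄ = ι-increasing (# 2) (# 3) (s<s (s<s z<s))
  1≤i₁ : 1 ≤ i₁
  1≤i₁ = proj₁ (ι-range (# 0))
  i₄≤N : i₄ ≤ suc n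
  i₄≤N = proj₂ (ι-range (# 3))

  a<c : a < c
  a<c = Equivalence.to (ι-order (# 2) (# 3)) (s<s z<s)
  c<b : c < b
  c<b = Equivalence.to (ι-order (# 3) (# 0)) (s<s (s<s z<s))
  b<wi₂ : b < w i₂
  b<wi₂ = Equivalence.to (ι-order (# 0) (# 1)) (s<s (s<s (s<s z<s)))

  wi₂≡N : w i₂ ≡ suc n
  wi₂≡N with x , wιx≡N ← proj₁ (proj₂ occ) =
    ≤-antisym (proj₂ (proj₂ occ) (# 1)) (subst (_≤ w i₂) wιx≡N (≤-wi₂ x))
    where
    ≤-wi₂ : ∀ x → w (ι x) ≤ w i₂
    ≤-wi₂ Fin.zero                                     = <⇒≤ b<wi₂
    ≤-wi₂ (Fin.suc Fin.zero)                           = ≤-refl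
    ≤-wi₂ (Fin.suc (Fin.suc Fin.zero))                 = <⇒≤ (<-trans a<c (<-trans c<b b<wi₂))
    ≤-wi₂ (Fin.suc (Fin.suc (Fin.suc Fin.zero)))       = <⇒≤ (<-trans c<b b<wi₂)

  1≤i₂ : 1 ≤ i₂
  1≤i₂ = ≤-trans 1≤i₁ (<⇒≤ i₁<i₂)
  1≤i₃ : 1 ≤ i₃
  1≤i₃ = ≤-trans 1≤i₂ (<⇒≤ i₂<i₃)
  i₃≤N : i₃ ≤ suc n
  i₃≤N = ≤-trans (<⇒≤ i₃<i₄) i₄≤N
  i₂≤N : i₂ ≤ suc n
  i₂≤N = ≤-trans (<⇒≤ i₂<i₃) i₃≤N
  i₁≤N : i₁ ≤ suc n
  i₁≤N = ≤-trans (<⇒≤ i₁<i₂) i₂≤N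

  <wi₂ : ∀ {j} → 1 ≤ j → j ≤ suc n → j ≢ i₂ → w j < w i₂
  <wi₂ {j} 1≤j j≤N j≢i₂ rewrite wi₂≡N =
    ≤∧≢⇒< (proj₂ (w-range j 1≤j j≤N))
          (λ wj≡N → j≢i₂ (w-injective j i₂ 1≤j j≤N 1≤i₂ i₂≤N (trans wj≡N (sym wi₂≡N))))

  -- A value between b and N left of i₃ would extend b N a c to 43512, 34512 or 35412.
  left-of-i₃ : ∀ {j} → 1 ≤ j → j < i₃ → j ≢ i₂ → w j ≤ b
  left-of-i₃ {j} 1≤j j<i₃ j≢i₂ with w j ≤? b
  ... | yes wj≤b = wj≤b
  ... | no wj≰b
    with b<wj ← ≰⇒> wj≰b
       | wj<wi₂ ← <wi₂ 1≤j (≤-trans (<⇒≤ j<i₃) i₃≤N) j≢i₂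
       | <-cmp j i₁
  ...   | tri< j<i₁ _ _ = contradiction
    (nOccurrence-by-ranks w-perm p43512
      (j ∷ i₁ ∷ i₂ ∷ i₃ ∷ i₄ ∷ []) (a ∷ c ∷ b ∷ w j ∷ w i₂ ∷ []) 1≤j i₄≤N
      (j<i₁ ∷ i₁<i₂ ∷ i₂<i₃ ∷ i₃<i₄ ∷ [-])
      (a<c ∷ c<b ∷ b<wj ∷ wj<wi₂ ∷ [-]) wi₂≡N refl)
    avoid43512
  ...   | tri≈ _ refl _ = contradiction ≤-refl wj≰b
  ...   | tri> _ _ i₁<j with <-cmp j i₂
  ...     | tri< j<i₂ _ _ = contradiction
    (nOccurrence-by-ranks w-perm p34512
      (i₁ ∷ j ∷ i₂ ∷ i₃ ∷ i₄ ∷ []) (a ∷ c ∷ b ∷ w j ∷ w i₂ ∷ []) 1≤i₁ i₄≤N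
      (i₁<j ∷ j<i₂ ∷ i₂<i₃ ∷ i₃<i₄ ∷ [-])
      (a<c ∷ c<b ∷ b<wj ∷ wj<wi₂ ∷ [-]) wi₂≡N refl)
    avoid34512
  ...     | tri≈ _ j≡i₂ _ = contradiction j≡i₂ j≢i₂
  ...     | tri> _ _ i₂<j = contradiction
    (nOccurrence-by-ranks w-perm p35412
      (i₁ ∷ i₂ ∷ j ∷ i₃ ∷ i₄ ∷ []) (a ∷ c ∷ b ∷ w j ∷ w i₂ ∷ []) 1≤i₁ i₄≤N
      (i₁<i₂ ∷ i₂<j ∷ j<i₃ ∷ i₃<i₄ ∷ [-])
      (a<c ∷ c<b ∷ b<wj ∷ wj<wi₂ ∷ [-]) wi₂≡N refl)
    avoid35412

  -- A value below c right of i₃ would extend b N a c to 45213, 45123, 45231 or 45132.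
  right-of-i₃ : ∀ {j} → i₃ < j → j ≤ suc n → c ≤ w j
  right-of-i₃ {j} i₃<j j≤N with c ≤? w j
  ... | yes c≤wj = c≤wj
  ... | no c≰wj with wj<c ← ≰⇒> c≰wj | <-cmp j i₄ | <-cmp (w j) a
  ...   | tri≈ _ refl _ | _ = contradiction ≤-refl c≰wj
  ...   | _ | tri≈ _ wj≡a _ = contradiction
    (w-injective j i₃ (≤-trans 1≤i₃ (<⇒≤ i₃<j)) j≤N 1≤i₃ i₃≤N wj≡a) (>⇒≢ i₃<j)
  ...   | tri< j<i₄ _ _ | tri< wj<a _ _ = contradiction
    (nOccurrence-by-ranks w-perm p45213
      (i₁ ∷ i₂ ∷ i₃ ∷ j ∷ i₄ ∷ []) (w j ∷ a ∷ c ∷ b ∷ w i₂ ∷ []) 1≤i₁ i₄≤N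
      (i₁<i₂ ∷ i₂<i₃ ∷ i₃<j ∷ j<i₄ ∷ [-])
      (wj<a ∷ a<c ∷ c<b ∷ b<wi₂ ∷ [-]) wi₂≡N refl)
    avoid45213
  ...   | tri< j<i₄ _ _ | tri> _ _ a<wj = contradiction
    (nOccurrence-by-ranks w-perm p45123
      (i₁ ∷ i₂ ∷ i₃ ∷ j ∷ i₄ ∷ []) (a ∷ w j ∷ c ∷ b ∷ w i₂ ∷ []) 1≤i₁ i₄≤N
      (i₁<i₂ ∷ i₂<i₃ ∷ i₃<j ∷ j<i₄ ∷ [-])
      (a<wj ∷ wj<c ∷ c<b ∷ b<wi₂ ∷ [-]) wi₂≡N refl)
    avoid45123
  ...   | tri> _ _ i₄<j | tri< wj<a _ _ = contradiction
    (nOccurrence-by-ranks w-perm p45231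
      (i₁ ∷ i₂ ∷ i₃ ∷ i₄ ∷ j ∷ []) (w j ∷ a ∷ c ∷ b ∷ w i₂ ∷ []) 1≤i₁ j≤N
      (i₁<i₂ ∷ i₂<i₃ ∷ i₃<i₄ ∷ i₄<j ∷ [-])
      (wj<a ∷ a<c ∷ c<b ∷ b<wi₂ ∷ [-]) wi₂≡N refl)
    avoid45231
  ...   | tri> _ _ i₄<j | tri> _ _ a<wj = contradiction
    (nOccurrence-by-ranks w-perm p45132
      (i₁ ∷ i₂ ∷ i₃ ∷ i₄ ∷ j ∷ []) (a ∷ w j ∷ c ∷ b ∷ w i₂ ∷ []) 1≤i₁ j≤N
      (i₁<i₂ ∷ i₂<i₃ ∷ i₃<i₄ ∷ i₄<j ∷ [-])
      (a<wj ∷ wj<c ∷ c<b ∷ b<wi₂ ∷ [-]) wi₂≡N refl)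
    avoid45132

  k : ℕ
  k = pred i₃

  1+k≡i₃ : suc k ≡ i₃
  1+k≡i₃ = suc-pred i₃ {{>-nonZero 1≤i₃}}

  i₂≤k : i₂ ≤ k
  i₂≤k = ≤-pred (subst (i₂ <_) (sym 1+k≡i₃) i₂<i₃)
  i₁≤k : i₁ ≤ k
  i₁≤k = ≤-trans (<⇒≤ i₁<i₂) i₂≤k

  j₄ : ℕ
  j₄ = pred i₄

  1+j₄≡i₄ : suc j₄ ≡ i₄
  1+j₄≡i₄ = suc-pred i₄ {{>-nonZero (≤-trans 1≤i₃ (<⇒≤ i₃<i₄))}}

  k<j₄ : k < j₄
  k<j₄ = ≤-pred (subst₂ _<_ (sym 1+k≡i₃) (sym 1+j₄≡i₄) i₃<i₄)
  j₄≤n : j₄ ≤ n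
  j₄≤n = ≤-pred (subst (_≤ suc n) (sym 1+j₄≡i₄) i₄≤N)
  k<n : k < n
  k<n = <-≤-trans k<j₄ j₄≤n

  W : ℕ → ℕ
  W = wbar w i₂

  W-perm : IsPerm n W
  W-perm = wbar-perm w-perm 1≤i₂ i₂≤N wi₂≡N

  W-prefix≤b : ∀ i → 1 ≤ i → i ≤ k → W i ≤ b
  W-prefix≤b i 1≤i i≤k rewrite wbar≡w∘punchIn w i₂ i with punchIn-bounds i₂ i
  ... | i≤j , j≤1+i
    with m≤n⇒m<n∨m≡n (subst (punchIn i₂ i ≤_) 1+k≡i₃ (≤-trans j≤1+i (s≤s i≤k)))
  ...   | inj₁ j<i₃ = left-of-i₃ (≤-trans 1≤i i≤j) j<i₃ (punchIn-≢ i₂ i)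
  ...   | inj₂ j≡i₃ rewrite j≡i₃ = <⇒≤ (<-trans a<c c<b)

  W-suffix : ∀ {j} → k < j → W j ≡ w (suc j)
  W-suffix k<j = wbar-≥ w (≤-trans i₂≤k (<⇒≤ k<j))

  W-k : W k ≡ a
  W-k = trans (wbar-≥ w i₂≤k) (cong w 1+k≡i₃)

  W-j₄ : W j₄ ≡ c
  W-j₄ = trans (W-suffix k<j₄) (cong w 1+j₄≡i₄)

  W-i₁ : W i₁ ≡ b
  W-i₁ = wbar-< w i₁<i₂

  Mk≡b : Mx W k ≡ b
  Mk≡b = trans
    (Mx-attained W 1≤i₁ i₁≤k λ i 1≤i i≤k → subst (W i ≤_) (sym W-i₁) (W-prefix≤b i 1≤i i≤k))
    W-i₁

  mk≡c : mn n W k ≡ c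
  mk≡c = trans
    (mn-attained n W k<n k<j₄ j₄≤n λ j k<j j≤n →
      subst₂ _≤_ (sym W-j₄) (sym (W-suffix k<j))
        (right-of-i₃ (subst (_< suc j) 1+k≡i₃ (s≤s k<j)) (s≤s j≤n)))
    W-j₄

  k<b : k < b
  k<b = prefix-bound W-perm W-prefix≤b k<j₄ j₄≤n (subst (_≤ b) (sym W-j₄) (<⇒≤ c<b))

  qpos≡i₂ : qpos (suc n) w ≡ i₂
  qpos≡i₂ = subst (λ v → posOf w (suc n) v ≡ i₂) wi₂≡N (posOf-inverse w-perm ≤-refl 1≤i₂ i₂≤N)

  w̄≡W : w̄ (suc n) w ≡ W
  w̄≡W = cong (wbar w) qpos≡i₂

  k∈newrep : InNewrep (suc n) w k
  k∈newrep = subst (λ q → InSupp n (wbar w q) k × q ≤ k) (sym qpos≡i₂)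
    ( crossing⇒InSupp W-perm 1≤i₁ (≤-trans i₁≤k (<⇒≤ k<n)) i₁≤k (subst (k <_) (sym W-i₁) k<b)
    , i₂≤k)

  M-k : Mx (w̄ (suc n) w) k ≡ b
  M-k = trans (cong (λ u → Mx u k) w̄≡W) Mk≡b

  m-k : mn n (w̄ (suc n) w) k ≡ c
  m-k = trans (cong (λ u → mn n u k) w̄≡W) mk≡c

  w̄-k : w̄ (suc n) w k ≡ a
  w̄-k = trans (cong (λ u → u k) w̄≡W) W-k

  M-k-left-of-N : posOf w (suc n) (Mx (w̄ (suc n) w) k) < qpos (suc n) w
  M-k-left-of-N = subst₂ _<_
    (sym (trans (cong (posOf w (suc n)) M-k) (posOf-inverse w-perm ≤-refl 1≤i₁ i₁≤N)))
    (sym qpos≡i₂) i₁<i₂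

  w̄-k≤m-k : w̄ (suc n) w k ≤ mn n (w̄ (suc n) w) k
  w̄-k≤m-k = subst₂ _≤_ (sym w̄-k) (sym m-k) (<⇒≤ a<c)

  𝔭≡ : 𝔭 (suc n) w k ≡ b ∷ suc n ∷ a ∷ c ∷ []
  𝔭≡ rewrite 𝔭-caseIII (suc n) w k M-k-left-of-N w̄-k≤m-k | M-k | w̄-k | m-k = refl

  values : ValuesEq w ι (b ∷ suc n ∷ a ∷ c ∷ [])
  values x = mk⇔ to from
    where
    to : (∃ λ y → w (ι y) ≡ x) → x ∈ b ∷ suc n ∷ a ∷ c ∷ []
    to (Fin.zero , refl)                               = here refl
    to (Fin.suc Fin.zero , refl)                       = there (here wi₂≡N)
    to (Fin.suc (Fin.suc Fin.zero) , refl)             = there (there (here refl))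
    to (Fin.suc (Fin.suc (Fin.suc Fin.zero)) , refl)   = there (there (there (here refl)))
    from : x ∈ b ∷ suc n ∷ a ∷ c ∷ [] → ∃ λ y → w (ι y) ≡ x
    from (here refl)                         = # 0 , refl
    from (there (here refl))                 = # 1 , wi₂≡N
    from (there (there (here refl)))         = # 2 , refl
    from (there (there (there (here refl)))) = # 3 , refl

corollary4p2p7 : (N : ℕ) (w : ℕ → ℕ) → IsPerm N w →
    ¬ HasNOcc N w p45231 → ¬ HasNOcc N w p45132 → ¬ HasNOcc N w p43512 →
    ¬ HasNOcc N w p34512 → ¬ HasNOcc N w p35412 → ¬ HasNOcc N w p45123 →
    ¬ HasNOcc N w p45213 →
    ∀ ι → NOccurrence N w p3412 ι →
      Σ ℕ (λ k → InNewrep N w k × ValuesEq w ι (𝔭 N w k))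
corollary4p2p7 zero w _ _ _ _ _ _ _ _ ι ((ι-range , _) , _) =
  contradiction (≤-trans (proj₁ (ι-range (# 0))) (proj₂ (ι-range (# 0)))) λ ()
corollary4p2p7 (suc n) w w-perm av₁ av₂ av₃ av₄ av₅ av₆ av₇ ι occ =
  k , k∈newrep , subst (ValuesEq w ι) (sym 𝔭≡) values
  where open Occurrence3412 n w w-perm av₁ av₂ av₃ av₄ av₅ av₆ av₇ ι occ
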